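{- Let $G$ be a finite, simple, undirected, connected graph with at least two vertices. If $\gamma_t(G) = \frac{1}{2}(\operatorname{diam}(G) + 1)$, then $G$ has a spanning tree $T$ which is a caterpillar and satisfies $\operatorname{diam}(T) = \operatorname{diam}(G)$.
   Context: A set $S \subseteq V(G)$ is a total dominating set of $G$ if every vertex of $G$ (including those in $S$) has a neighbor in $S$; $\gamma_t(G)$ is the minimum cardinality of a total dominating set. $\operatorname{diam}(G)$ denotes the maximum distance between two vertices of $G$. A caterpillar is a tree such that removing all its leaves (vertices of degree one) yields a path. -}

module Defs where

open import Data.Nat using (ℕ; zero; suc; _+_; _*_; _<_; _≤_)
open import Data.Fin using (Fin; toℕ)
open import Data.Bool using (Bool; true; false)
open import Data.List using (List; length; lookup)
open import Data.List.Membership.Propositional using (_∈_)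
open import Data.List.Relation.Unary.Unique.Propositional using (Unique)
open import Data.Fin.Subset using (Subset; ∣_∣)
  renaming (_∈_ to _∈ₛ_)
open import Data.Vec using (tabulate)
open import Data.Product using (Σ; ∃; ∃-syntax; _×_; _,_)
open import Data.Sum using (_⊎_)
open import Data.Empty using (⊥)
open import Relation.Nullary using (¬_)
open import Relation.Binary.PropositionalEquality using (_≡_; _≢_)
open import Function.Bundles using (_⇔_)

record Graph (n : ℕ) : Set where
  field
    adj    : Fin n → Fin n → Bool
    sym    : ∀ u v → adj u v ≡ adj v u
    irrefl : ∀ v → adj v v ≡ false

open Graph public

Edge : ∀ {n} → Graph n → Fin n → Fin n → Set
Edge G u v = adj G u v ≡ true

data Walk {n} (G : Graph n) : Fin n → Fin n → ℕ → Set where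
  [] : ∀ {v} → Walk G v v 0
  _∷_ : ∀ {u w v k} → Edge G u w → Walk G w v k → Walk G u v (suc k)

Connected : ∀ {n} → Graph n → Set
Connected G = ∀ u v → ∃[ k ] Walk G u v k

Dist : ∀ {n} → Graph n → Fin n → Fin n → ℕ → Set
Dist G u v d = Walk G u v d × (∀ k → k < d → ¬ Walk G u v k)

Diam : ∀ {n} → Graph n → ℕ → Set
Diam G d = (∀ u v → ∃[ k ] (k ≤ d × Dist G u v k))
         × (∃[ u ] ∃[ v ] Dist G u v d)

IsTotalDominating : ∀ {n} → Graph n → Subset n → Set
IsTotalDominating G S = ∀ v → ∃[ u ] (u ∈ₛ S × Edge G v u)

TotalDominationNumber : ∀ {n} → Graph n → ℕ → Set
TotalDominationNumber {n} G k =
  (∃[ S ] (IsTotalDominating G S × ∣ S ∣ ≡ k))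
  × (∀ S → IsTotalDominating G S → k ≤ ∣ S ∣)

degree : ∀ {n} → Graph n → Fin n → ℕ
degree G v = ∣ tabulate (adj G v) ∣

data Path {n} (G : Graph n) : Fin n → List (Fin n) → Fin n → Set where
  one  : ∀ {v} → Path G v Data.List.[] v
  step : ∀ {u w v vs} → Edge G u w → Path G w vs v → Path G u (w Data.List.∷ vs) v

IsCycle : ∀ {n} → Graph n → List (Fin n) → Set
IsCycle G Data.List.[] = ⊥
IsCycle G (x Data.List.∷ xs) =
  Unique (x Data.List.∷ xs) × 3 ≤ length (x Data.List.∷ xs)
  × ∃[ y ] (Path G x xs y × Edge G y x)

Acyclic : ∀ {n} → Graph n → Set
Acyclic G = ∀ cs → ¬ IsCycle G cs

IsTree : ∀ {n} → Graph n → Set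
IsTree G = Connected G × Acyclic G

SpanningSubgraph : ∀ {n} → Graph n → Graph n → Set
SpanningSubgraph T G = ∀ u v → Edge T u v → Edge G u v

IsLeaf : ∀ {n} → Graph n → Fin n → Set
IsLeaf G v = degree G v ≡ 1

-- The graph obtained from G by deleting all leaves is a path: the non-leaf
-- vertices can be listed without repetition as p₀,…,p_m so that two of them are
-- adjacent iff they are consecutive in the list (the empty list, i.e. the null
-- graph, is accepted, as for K₂).
LeafDeletionIsPath : ∀ {n} → Graph n → Set
LeafDeletionIsPath {n} G =
  Σ (List (Fin n)) λ p →
    Unique p
    × (∀ v → (v ∈ p) ⇔ (¬ IsLeaf G v))
    × (∀ (i j : Fin (length p)) →
         Edge G (lookup p i) (lookup p j)
           ⇔ (toℕ i ≡ suc (toℕ j) ⊎ toℕ j ≡ suc (toℕ i)))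

IsCaterpillar : ∀ {n} → Graph n → Set
IsCaterpillar G = IsTree G × LeafDeletionIsPath G

-- Layer the vertices by their distance ℓ to one end u of a diametral path u … v, and let
-- σ i be the number of vertices of a minimum total dominating set S in layer i. Every
-- layer is dominated from a neighbouring layer, and every vertex of S has an S-neighbour in
-- its own or a neighbouring layer; so every four consecutive layers carry at least two
-- vertices of S, and 2|S| = d + 1 forces d ≡ 3 (mod 4) with σ reading 0,1,1,0 on every
-- block of four layers. A shortest path from v to u that steps into S whenever it can then
-- contains all of S at interior positions, and hanging every other vertex from its
-- dominator turns this path into the spine of a spanning caterpillar of diameter d.

module Submission where

open import Defs hiding (sym)
open import Data.Bool using (Bool; true; false; _∧_)
open import Data.Bool.Properties using (∧-zeroʳ)
open import Data.Empty using (⊥; ⊥-elim)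
open import Data.Fin using (Fin; zero; suc; toℕ)
import Data.Fin.Properties as Fin
open import Data.Fin.Subset using (Subset; ∣_∣) renaming (_∈_ to _∈ₛ_)
open import Data.Fin.Subset.Properties using (_∈?_)
open import Data.List using (List; []; _∷_; length)
import Data.List as List
import Data.List.Properties as List
open import Data.List.Membership.Propositional using (_∈_)
import Data.List.Relation.Unary.All as All
open import Data.List.Relation.Unary.AllPairs using (_∷_)
open import Data.List.Relation.Unary.Any using (here; there; any?)
open import Data.List.Relation.Unary.Unique.Propositional using (Unique)
open import Data.List.Relation.Unary.Unique.Propositional.Properties using (applyUpTo⁺₁)
open import Data.List.Membership.Propositional.Properties using (∈-applyUpTo⁺; ∈-applyUpTo⁻)
open import Data.Nat using (ℕ; zero; suc; _+_; _*_; _∸_; _≤_; _<_; z≤n; s≤s; _≟_; _≤?_)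
open import Data.Nat.Properties
open import Data.Nat.DivMod using (_%_; _/_; m%n<n; m≡m%n+[m/n]*n)
open import Algebra.Properties.CommutativeMonoid.Sum +-0-commutativeMonoid
  using (sum; ∑-distrib-+; sum-cong-≗; sum-replicate-zero)
open import Data.Nat.Tactic.RingSolver using (solve-∀)
open import Data.Product using (Σ; ∃-syntax; _×_; _,_; proj₁; proj₂)
open import Data.Sum using (_⊎_; inj₁; inj₂)
open import Data.Vec using (tabulate; lookup)
import Data.Vec.Properties as Vec
open import Function using (_∘_; case_of_)
open import Function.Bundles using (_⇔_; mk⇔; Equivalence)
open import Relation.Binary.PropositionalEquality
open import Relation.Binary.Definitions using (tri<; tri≈; tri>)
open import Relation.Nullary using (¬_; Dec; yes; no; ¬?; _×-dec_; _⊎-dec_)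
open import Relation.Nullary.Decidable using (⌊_⌋; decidable-stable)

indicator : Bool → ℕ
indicator true  = 1
indicator false = 0

count : ∀ {n} → (Fin n → Bool) → ℕ
count f = sum (indicator ∘ f)

term≤sum : ∀ {n} (f : Fin n → ℕ) i → f i ≤ sum f
term≤sum f zero    = m≤m+n _ _
term≤sum f (suc i) = ≤-trans (term≤sum (f ∘ suc) i) (m≤n+m _ _)

count-≥1 : ∀ {n} (f : Fin n → Bool) {w} → f w ≡ true → 1 ≤ count f
count-≥1 f {w} fw = subst (_≤ count f) (cong indicator fw) (term≤sum (indicator ∘ f) w)

count-≥2 : ∀ {n} (f : Fin n → Bool) {w w′} → f w ≡ true → f w′ ≡ true → w ≢ w′ → 2 ≤ count f
count-≥2 f {zero}  {zero}   _  _   w≢w′ = ⊥-elim (w≢w′ refl)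
count-≥2 f {zero}  {suc w′} fw fw′ _    rewrite fw  = s≤s (count-≥1 (f ∘ suc) fw′)
count-≥2 f {suc w} {zero}   fw fw′ _    rewrite fw′ = s≤s (count-≥1 (f ∘ suc) fw)
count-≥2 f {suc w} {suc w′} fw fw′ w≢w′ =
  ≤-trans (count-≥2 (f ∘ suc) fw fw′ (w≢w′ ∘ cong suc)) (m≤n+m _ _)

count-witness : ∀ {n} (f : Fin n → Bool) → 1 ≤ count f → ∃[ w ] f w ≡ true
count-witness {suc n} f pos with f zero in f0
... | true  = zero , f0
... | false = let w , fw = count-witness (f ∘ suc) pos in suc w , fw

count-none : ∀ {n} (f : Fin n → Bool) → (∀ w → f w ≡ false) → count f ≡ 0
count-none {zero}  f none = refl
count-none {suc n} f none rewrite none zero = count-none (f ∘ suc) (none ∘ suc)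

count-unique : ∀ {n} (f : Fin n → Bool) {w} → f w ≡ true → (∀ w′ → f w′ ≡ true → w′ ≡ w) →
               count f ≡ 1
count-unique f {zero} fw unique rewrite fw = cong suc (count-none (f ∘ suc) others)
  where
  others : ∀ w′ → f (suc w′) ≡ false
  others w′ with f (suc w′) in fw′
  ... | true  = case (unique (suc w′) fw′) of λ ()
  ... | false = refl
count-unique f {suc w} fw unique with f zero in f0
... | true  = case (unique zero f0) of λ ()
... | false = count-unique (f ∘ suc) fw (λ w′ fw′ → Fin.suc-injective (unique (suc w′) fw′))

∣tabulate∣≡count : ∀ {n} (f : Fin n → Bool) → ∣ tabulate f ∣ ≡ count f
∣tabulate∣≡count {zero}  f = refl
∣tabulate∣≡count {suc n} f with f zero
... | true  = cong suc (∣tabulate∣≡count (f ∘ suc))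
... | false = ∣tabulate∣≡count (f ∘ suc)

∣S∣≡count : ∀ {n} (S : Subset n) → ∣ S ∣ ≡ count (lookup S)
∣S∣≡count S = trans (cong ∣_∣ (sym (Vec.tabulate∘lookup S))) (∣tabulate∣≡count (lookup S))

prefixSum : (ℕ → ℕ) → ℕ → ℕ
prefixSum σ zero    = 0
prefixSum σ (suc m) = prefixSum σ m + σ m

prefixSum-sum-comm : ∀ {n} (H : Fin n → ℕ → ℕ) m →
                     prefixSum (λ i → sum (λ w → H w i)) m ≡ sum (λ w → prefixSum (H w) m)
prefixSum-sum-comm {n} H zero    = sym (sum-replicate-zero n)
prefixSum-sum-comm     H (suc m) =
  trans (cong (_+ sum (λ w → H w m)) (prefixSum-sum-comm H m))
        (sym (∑-distrib-+ (λ w → prefixSum (H w) m) (λ w → H w m)))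

prefixSum-zero : ∀ m → prefixSum (λ _ → 0) m ≡ 0
prefixSum-zero zero    = refl
prefixSum-zero (suc m) = trans (+-identityʳ _) (prefixSum-zero m)

prefixSum-indicator : ∀ a m → a < m → prefixSum (λ i → indicator ⌊ a ≟ i ⌋) m ≡ 1
prefixSum-indicator a (suc m) a<1+m with a ≟ m
... | yes refl = cong (_+ 1) (below a a ≤-refl)
  where
  below : ∀ a m → m ≤ a → prefixSum (λ i → indicator ⌊ a ≟ i ⌋) m ≡ 0
  below a zero    _   = refl
  below a (suc m) m<a with a ≟ m
  ... | yes refl = ⊥-elim (1+n≰n m<a)
  ... | no _     = trans (+-identityʳ _) (below a m (<⇒≤ m<a))
... | no a≢m = trans (+-identityʳ _) (prefixSum-indicator a m (≤∧≢⇒< (≤-pred a<1+m) a≢m))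

module WalkProperties {n} (G : Graph n) where

  edge-sym : ∀ {a b} → Edge G a b → Edge G b a
  edge-sym {a} {b} e = trans (Graph.sym G b a) e

  edge⇒≢ : ∀ {a b} → Edge G a b → a ≢ b
  edge⇒≢ {a} e refl = case trans (sym e) (Graph.irrefl G a) of λ ()

  edge? : ∀ a b → Dec (Edge G a b)
  edge? a b with adj G a b
  ... | true  = yes refl
  ... | false = no λ ()

  _∷ʳ_ : ∀ {a b c k} → Walk G a b k → Edge G b c → Walk G a c (suc k)
  []      ∷ʳ e = e ∷ []
  (x ∷ w) ∷ʳ e = x ∷ (w ∷ʳ e)

  reverse : ∀ {a b k} → Walk G a b k → Walk G b a k
  reverse []      = []
  reverse (e ∷ w) = reverse w ∷ʳ edge-sym e

  _++_ : ∀ {a b c k m} → Walk G a b k → Walk G b c m → Walk G a c (k + m)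
  []      ++ w′ = w′
  (e ∷ w) ++ w′ = e ∷ (w ++ w′)

  walk₀⇒≡ : ∀ {a b} → Walk G a b 0 → a ≡ b
  walk₀⇒≡ [] = refl

  walk? : ∀ a b k → Dec (Walk G a b k)
  walk? a b zero with a Fin.≟ b
  ... | yes refl = yes []
  ... | no a≢b   = no (a≢b ∘ walk₀⇒≡)
  walk? a b (suc k) with Fin.any? (λ w → edge? a w ×-dec walk? w b k)
  ... | yes (w , e , p) = yes (e ∷ p)
  ... | no ∄w           = no λ { (_∷_ {w = w} e p) → ∄w (w , e , p) }

  dist≤length : ∀ {a b k m} → Dist G a b k → Walk G a b m → k ≤ m
  dist≤length {k = k} {m} (_ , minimal) w with k ≤? m
  ... | yes k≤m = k≤m
  ... | no  k≰m = ⊥-elim (minimal m (≰⇒> k≰m) w)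

  shortest-from : ∀ {a b} j r → (∀ k → k < j → ¬ Walk G a b k) → Walk G a b (j + r) →
                  ∃[ k ] k ≤ j + r × Dist G a b k
  shortest-from {a} {b} j r none w with walk? a b j
  ... | yes wj = j , m≤m+n j r , wj , none
  shortest-from {a} {b} j zero    none w | no ¬wj =
    ⊥-elim (¬wj (subst (Walk G a b) (+-identityʳ j) w))
  shortest-from {a} {b} j (suc r) none w | no ¬wj =
    let k , k≤ , dist = shortest-from (suc j) r none′ (subst (Walk G a b) (+-suc j r) w)
    in k , subst (k ≤_) (sym (+-suc j r)) k≤ , dist
    where
    none′ : ∀ k → k < suc j → ¬ Walk G a b k
    none′ k k<1+j with m≤n⇒m<n∨m≡n (≤-pred k<1+j)
    ... | inj₁ k<j  = none k k<j
    ... | inj₂ refl = ¬wj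

  shortest : ∀ {a b m} → Walk G a b m → ∃[ k ] k ≤ m × Dist G a b k
  shortest {m = m} = shortest-from 0 m (λ _ ())

walk-mono : ∀ {n} {T G : Graph n} → SpanningSubgraph T G → ∀ {a b k} → Walk T a b k → Walk G a b k
walk-mono T⊆G []                          = []
walk-mono T⊆G (_∷_ {u = u} {w = w} e p) = T⊆G u w e ∷ walk-mono T⊆G p

prev : (ℕ → ℕ) → ℕ → ℕ
prev σ zero    = 0
prev σ (suc i) = σ i

around : (ℕ → ℕ) → ℕ → ℕ
around σ i = prev σ i + σ i + σ (suc i)

around-one : ∀ σ i j → j ≡ suc i ⊎ j ≡ i ⊎ i ≡ suc j → σ j ≤ around σ i
around-one σ i _       (inj₁ refl)        = m≤n+m _ _
around-one σ i _       (inj₂ (inj₁ refl)) = ≤-trans (m≤n+m (σ i) (prev σ i)) (m≤m+n _ _)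
around-one σ _ j       (inj₂ (inj₂ refl)) = ≤-trans (m≤m+n _ _) (m≤m+n _ _)

around-two : ∀ σ i j → j ≡ suc i ⊎ i ≡ suc j → σ i + σ j ≤ around σ i
around-two σ i _ (inj₁ refl) = +-monoˡ-≤ (σ (suc i)) (m≤n+m (σ i) (prev σ i))
around-two σ _ j (inj₂ refl) = ≤-trans (≤-reflexive (+-comm (σ (suc j)) (σ j))) (m≤m+n _ _)

Block0110 : (ℕ → ℕ) → ℕ → Set
Block0110 σ j = σ (j * 4) ≡ 0 × σ (1 + j * 4) ≡ 1 × σ (2 + j * 4) ≡ 1 × σ (3 + j * 4) ≡ 0

private
  drop-zero : ∀ {a b c k} → a ≡ 0 → k ≤ a + b + c → k ≤ b + c
  drop-zero refl h = h

  drop-last-zero : ∀ {a b c k} → c ≡ 0 → k ≤ a + b + c → k ≤ a + b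
  drop-last-zero {a} {b} {k = k} refl h = subst (k ≤_) (+-identityʳ (a + b)) h

  drop-zeros : ∀ {a b c k} → a ≡ 0 → b ≡ 0 → k ≤ a + b + c → k ≤ c
  drop-zeros refl refl h = h

  two-terms : ∀ {b x} → 2 ≤ b → b + x ≤ 2 → b ≡ 2 × x ≡ 0
  two-terms {2}                 {zero}  _ _                 = refl , refl
  two-terms {2}                 {suc x} _ (s≤s (s≤s ()))
  two-terms {suc (suc (suc b))} _       (s≤s (s≤s ()))
  two-terms {1}                 (s≤s ()) _

  tail-zeros : ∀ {s c e} → 2 ≤ s → s + c + e ≡ 2 → c ≡ 0 × e ≡ 0
  tail-zeros {s} {c} {e} 2≤s s+c+e≡2 =
    let c+e≡0 = proj₂ (two-terms 2≤s (≤-reflexive (trans (sym (+-assoc s c e)) s+c+e≡2)))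
    in m+n≡0⇒m≡0 c c+e≡0 , m+n≡0⇒n≡0 c c+e≡0

  both-one : ∀ {b c} → 1 ≤ b → 1 ≤ c → b + c + 0 ≡ 2 → b ≡ 1 × c ≡ 1
  both-one {1}               {1}           _ _ _ = refl , refl
  both-one {1}               {suc (suc _)} _ _ ()
  both-one {2}               {suc _}       _ _ ()
  both-one {suc (suc (suc _))} {suc _}     _ _ ()

  sum₄-≥2 : ∀ a b c e → 1 ≤ a + b + c → 1 ≤ b + c + e →
            (1 ≤ b → 2 ≤ a + b + c) → (1 ≤ c → 2 ≤ b + c + e) → 2 ≤ a + b + c + e
  sum₄-≥2 a (suc b) c       e _   _   pb _  = ≤-trans (pb (s≤s z≤n)) (m≤m+n _ e)
  sum₄-≥2 a zero    (suc c) e _   _   _  pc = ≤-trans (pc (s≤s z≤n)) (+-monoˡ-≤ e (m≤n+m _ (a + 0)))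
  sum₄-≥2 a zero    zero    e ca  ce  _  _  = +-mono-≤ ca ce

  ≱1⇒≡0 : ∀ {n} → ¬ 1 ≤ n → n ≡ 0
  ≱1⇒≡0 = n<1⇒n≡0 ∘ ≰⇒>

  regroup₄ : ∀ p a b c e → p + a + b + c + e ≡ p + (a + b + c + e)
  regroup₄ = solve-∀

  double-even : ∀ M → 2 * (M * 2) ≡ M * 4
  double-even = solve-∀

  double-odd : ∀ M → 2 * (1 + M * 2) ≡ 2 + M * 4
  double-odd = solve-∀

  parity : ∀ k → ∃[ M ] (k ≡ M * 2 ⊎ k ≡ 1 + M * 2)
  parity zero          = 0 , inj₁ refl
  parity (suc zero)    = 0 , inj₂ refl
  parity (suc (suc k)) with parity k
  ... | M , inj₁ k≡2M   = suc M , inj₁ (cong (2 +_) k≡2M)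
  ... | M , inj₂ k≡1+2M = suc M , inj₂ (cong (2 +_) k≡1+2M)

prefixSum-≥ : ∀ M (B : ℕ → ℕ) → (∀ j → j < M → 2 ≤ B j) → M * 2 ≤ prefixSum B M
prefixSum-≥ zero    B _   = z≤n
prefixSum-≥ (suc M) B B≥2 = subst (_≤ prefixSum B M + B M) (+-comm (M * 2) 2)
  (+-mono-≤ (prefixSum-≥ M B (λ j j<M → B≥2 j (m<n⇒m<1+n j<M))) (B≥2 M ≤-refl))

prefixSum-tight : ∀ M (B : ℕ → ℕ) → (∀ j → j < M → 2 ≤ B j) →
                  ∀ x → prefixSum B M + x ≤ M * 2 → (∀ j → j < M → B j ≡ 2) × x ≡ 0
prefixSum-tight zero    B _   x h = (λ _ ()) , n≤0⇒n≡0 h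
prefixSum-tight (suc M) B B≥2 x h = tight , x≡0
  where
  B≥2′ : ∀ j → j < M → 2 ≤ B j
  B≥2′ j j<M = B≥2 j (m<n⇒m<1+n j<M)
  p = prefixSum B M
  h′ : p + (B M + x) ≤ M * 2 + 2
  h′ = subst₂ _≤_ (+-assoc p (B M) x) (+-comm 2 (M * 2)) h
  last : B M ≡ 2 × x ≡ 0
  last = two-terms (B≥2 M ≤-refl)
           (+-cancelˡ-≤ (M * 2) _ _ (≤-trans (+-monoˡ-≤ (B M + x) (prefixSum-≥ M B B≥2′)) h′))
  x≡0 = proj₂ last
  p≤ : p + 0 ≤ M * 2
  p≤ = subst (_≤ M * 2) (sym (+-identityʳ p))
         (+-cancelʳ-≤ 2 p (M * 2) (subst (λ y → p + y ≤ M * 2 + 2)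
           (trans (cong (B M +_) x≡0) (trans (+-identityʳ _) (proj₁ last))) h′))
  tight : ∀ j → j < suc M → B j ≡ 2
  tight j j<1+M with m≤n⇒m<n∨m≡n (≤-pred j<1+M)
  ... | inj₁ j<M  = proj₁ (prefixSum-tight M B B≥2′ 0 p≤) j j<M
  ... | inj₂ refl = proj₁ last

module BlockPattern (σ : ℕ → ℕ) (d : ℕ) (vanishes : σ (suc d) ≡ 0)
  (covered : ∀ i → i ≤ d → 1 ≤ around σ i)
  (paired  : ∀ i → i ≤ d → 1 ≤ σ i → 2 ≤ around σ i) where

  block : ℕ → ℕ
  block j = σ (j * 4) + σ (1 + j * 4) + σ (2 + j * 4) + σ (3 + j * 4)

  prefixSum-blocks : ∀ M → prefixSum σ (M * 4) ≡ prefixSum block M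
  prefixSum-blocks zero    = refl
  prefixSum-blocks (suc M) =
    trans (regroup₄ (prefixSum σ (M * 4)) _ _ _ _) (cong (_+ block M) (prefixSum-blocks M))

  block-≥2 : ∀ j → 3 + j * 4 ≤ d → 2 ≤ block j
  block-≥2 j 3+4j≤d = sum₄-≥2 _ _ _ _ (covered _ 1+4j≤d) (covered _ 2+4j≤d)
                                      (paired _ 1+4j≤d) (paired _ 2+4j≤d)
    where
    1+4j≤d = ≤-trans (m≤n+m _ 2) 3+4j≤d
    2+4j≤d = ≤-trans (m≤n+m _ 1) 3+4j≤d

  -- The state that forces the shifted pattern 1,1,0,0 on block j, which cannot end properly.
  Shifted : ℕ → Set
  Shifted j = prev σ (j * 4) ≡ 0 × 1 ≤ σ (j * 4)

  module Tight (M : ℕ) (M*4≤1+d : M * 4 ≤ suc d) (tight : ∀ j → j < M → block j ≡ 2)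
               (¬shifted-M : ¬ Shifted M) where

    last-index : ∀ j → j < M → 3 + j * 4 ≤ d
    last-index j j<M = ≤-pred (≤-trans (*-monoˡ-≤ 4 j<M) M*4≤1+d)

    shifted-step : ∀ j → j < M → Shifted j → Shifted (suc j)
    shifted-step j j<M (p≡0 , σ₀≥1) =
      σ₃≡0 , drop-zeros σ₂≡0 σ₃≡0 (covered (3 + j * 4) (last-index j j<M))
      where
      σ₀+σ₁≥2 : 2 ≤ σ (j * 4) + σ (1 + j * 4)
      σ₀+σ₁≥2 = drop-zero p≡0 (paired (j * 4) (≤-trans (m≤n+m _ 3) (last-index j j<M)) σ₀≥1)
      σ₂≡0 = proj₁ (tail-zeros σ₀+σ₁≥2 (tight j j<M))
      σ₃≡0 = proj₂ (tail-zeros σ₀+σ₁≥2 (tight j j<M))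

    never-shifted : ∀ r j → j + r ≡ M → ¬ Shifted j
    never-shifted zero    j j+0≡M = subst (¬_ ∘ Shifted) (trans (sym j+0≡M) (+-identityʳ j)) ¬shifted-M
    never-shifted (suc r) j j+r≡M =
      never-shifted r (suc j) (trans (sym (+-suc j r)) j+r≡M)
      ∘ shifted-step j (subst (j <_) j+r≡M (m<m+n j (s≤s z≤n)))

    ¬shifted : ∀ j → j ≤ M → ¬ Shifted j
    ¬shifted j j≤M = never-shifted (M ∸ j) j (m+[n∸m]≡n j≤M)

    block-step : ∀ j → j < M → prev σ (j * 4) ≡ 0 → Block0110 σ j
    block-step j j<M p≡0 = σ₀≡0 , proj₁ σ₁σ₂≡1 , proj₂ σ₁σ₂≡1 , σ₃≡0
      where
      σ₀≡0 : σ (j * 4) ≡ 0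
      σ₀≡0 = ≱1⇒≡0 (λ σ₀≥1 → ¬shifted j (<⇒≤ j<M) (p≡0 , σ₀≥1))
      σ₁≥1 : 1 ≤ σ (1 + j * 4)
      σ₁≥1 = drop-zeros p≡0 σ₀≡0 (covered (j * 4) (≤-trans (m≤n+m _ 3) (last-index j j<M)))
      σ₁+σ₂≥2 : 2 ≤ σ (1 + j * 4) + σ (2 + j * 4)
      σ₁+σ₂≥2 = drop-zero σ₀≡0 (paired (1 + j * 4) (≤-trans (m≤n+m _ 2) (last-index j j<M)) σ₁≥1)
      σ₁+σ₂+σ₃≡2 : σ (1 + j * 4) + σ (2 + j * 4) + σ (3 + j * 4) ≡ 2
      σ₁+σ₂+σ₃≡2 =
        subst (λ a → a + σ (1 + j * 4) + σ (2 + j * 4) + σ (3 + j * 4) ≡ 2) σ₀≡0 (tight j j<M)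
      σ₃≡0 : σ (3 + j * 4) ≡ 0
      σ₃≡0 = proj₂ (two-terms σ₁+σ₂≥2 (≤-reflexive σ₁+σ₂+σ₃≡2))
      σ₂≥1 : 1 ≤ σ (2 + j * 4)
      σ₂≥1 = n≢0⇒n>0 λ σ₂≡0 →
        ¬shifted (suc j) j<M (σ₃≡0 , drop-zeros σ₂≡0 σ₃≡0 (covered (3 + j * 4) (last-index j j<M)))
      σ₁σ₂≡1 = both-one σ₁≥1 σ₂≥1
        (subst (λ e → σ (1 + j * 4) + σ (2 + j * 4) + e ≡ 2) σ₃≡0 σ₁+σ₂+σ₃≡2)

    block-0110 : ∀ j → j < M → Block0110 σ j
    starts-fresh : ∀ j → j ≤ M → prev σ (j * 4) ≡ 0
    block-0110 j j<M = block-step j j<M (starts-fresh j (<⇒≤ j<M))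
    starts-fresh zero    _   = refl
    starts-fresh (suc j) j<M = proj₂ (proj₂ (proj₂ (block-0110 j j<M)))

  module _ (M : ℕ) (sum≡ : prefixSum σ (suc d) ≡ 2 + M * 2) (1+d≡ : suc d ≡ 4 + M * 4) where

    private
      B≥2 : ∀ j → j < suc M → 2 ≤ block j
      B≥2 j j<1+M = block-≥2 j (≤-pred (≤-trans (*-monoˡ-≤ 4 j<1+M) (≤-reflexive (sym 1+d≡))))

      sum-blocks : prefixSum block (suc M) + 0 ≡ suc M * 2
      sum-blocks = begin
        prefixSum block (suc M) + 0  ≡⟨ +-identityʳ _ ⟩
        prefixSum block (suc M)      ≡⟨ prefixSum-blocks (suc M) ⟨
        prefixSum σ (suc M * 4)      ≡⟨ cong (prefixSum σ) 1+d≡ ⟨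
        prefixSum σ (suc d)          ≡⟨ sum≡ ⟩
        suc M * 2                    ∎
        where open ≡-Reasoning

      ¬shifted-end : ¬ Shifted (suc M)
      ¬shifted-end (_ , σ≥1) = case subst (1 ≤_) vanishes (subst (λ i → 1 ≤ σ i) (sym 1+d≡) σ≥1) of λ ()

    blocks-0110 : ∀ j → j ≤ M → Block0110 σ j
    blocks-0110 j j≤M =
      Tight.block-0110 (suc M) (≤-reflexive (sym 1+d≡))
        (proj₁ (prefixSum-tight (suc M) block B≥2 0 (≤-reflexive sum-blocks))) ¬shifted-end j (s≤s j≤M)

  module _ (M : ℕ) (sum≡ : prefixSum σ (suc d) ≡ 1 + M * 2) (1+d≡ : suc d ≡ 2 + M * 4) where

    private
      σ₀ = σ (M * 4)
      σ₁ = σ (1 + M * 4)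
      M*4<d : M * 4 < d
      M*4<d = ≤-reflexive (suc-injective (sym 1+d≡))
      B≥2 : ∀ j → j < M → 2 ≤ block j
      B≥2 j j<M = block-≥2 j (≤-trans (n≤1+n _) (≤-trans (*-monoˡ-≤ 4 j<M) (<⇒≤ M*4<d)))
      σ₂≡0 : σ (2 + M * 4) ≡ 0
      σ₂≡0 = subst (λ i → σ i ≡ 0) 1+d≡ vanishes
      sum-blocks : prefixSum block M + (σ₀ + σ₁) ≡ 1 + M * 2
      sum-blocks = begin
        prefixSum block M + (σ₀ + σ₁)   ≡⟨ +-assoc _ σ₀ σ₁ ⟨
        prefixSum block M + σ₀ + σ₁     ≡⟨ cong (λ p → p + σ₀ + σ₁) (prefixSum-blocks M) ⟨
        prefixSum σ (2 + M * 4)         ≡⟨ cong (prefixSum σ) 1+d≡ ⟨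
        prefixSum σ (suc d)             ≡⟨ sum≡ ⟩
        1 + M * 2                       ∎
        where open ≡-Reasoning
      σ₀+σ₁≥1 : 1 ≤ σ₀ + σ₁
      σ₀+σ₁≥1 = drop-last-zero {σ₀} {σ₁} σ₂≡0 (covered (1 + M * 4) M*4<d)
      x = σ₀ + σ₁ ∸ 1
      1+x≡σ₀+σ₁ : suc x ≡ σ₀ + σ₁
      1+x≡σ₀+σ₁ = trans (+-comm 1 x) (m∸n+n≡m σ₀+σ₁≥1)
      tight = prefixSum-tight M block B≥2 x (≤-reflexive (suc-injective (begin
        suc (prefixSum block M + x)     ≡⟨ +-suc _ x ⟨
        prefixSum block M + suc x       ≡⟨ cong (prefixSum block M +_) 1+x≡σ₀+σ₁ ⟩
        prefixSum block M + (σ₀ + σ₁)   ≡⟨ sum-blocks ⟩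
        1 + M * 2                       ∎)))
        where open ≡-Reasoning
      σ₀+σ₁≡1 : σ₀ + σ₁ ≡ 1
      σ₀+σ₁≡1 = trans (sym 1+x≡σ₀+σ₁) (cong suc (proj₂ tight))
      ¬shifted-end : ¬ Shifted M
      ¬shifted-end (p≡0 , σ₀≥1) =
        1+n≰n (subst (2 ≤_) σ₀+σ₁≡1 (drop-zero p≡0 (paired (M * 4) (<⇒≤ M*4<d) σ₀≥1)))
      σ₀≡0 : σ₀ ≡ 0
      σ₀≡0 = ≱1⇒≡0 (λ σ₀≥1 →
        ¬shifted-end (Tight.starts-fresh M (m≤n⇒m≤1+n (<⇒≤ M*4<d)) (proj₁ tight) ¬shifted-end M ≤-refl
                     , σ₀≥1))

    ¬d≡1-mod-4 : ⊥
    ¬d≡1-mod-4 = 1+n≰n (subst (2 ≤_) σ₀+σ₁≡1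
      (drop-last-zero {σ₀} {σ₁} σ₂≡0 (paired (1 + M * 4) (≤-reflexive (suc-injective (sym 1+d≡))) σ₁≥1)))
      where
      σ₁≥1 : 1 ≤ σ₁
      σ₁≥1 = ≤-reflexive (sym (subst (λ a → a + σ₁ ≡ 1) σ₀≡0 σ₀+σ₁≡1))

  block-pattern : ∀ k → prefixSum σ (suc d) ≡ k → 2 * k ≡ d + 1 →
                  ∃[ M ] d ≡ 3 + M * 4 × (∀ j → j ≤ M → Block0110 σ j)
  block-pattern k sum≡k 2k≡1+d with parity k
  ... | zero  , inj₁ refl = case trans (+-comm 1 d) (sym 2k≡1+d) of λ ()
  ... | suc M , inj₁ refl = M , suc-injective 1+d≡ , blocks-0110 M sum≡k 1+d≡
    where 1+d≡ = trans (trans (+-comm 1 d) (sym 2k≡1+d)) (double-even (suc M))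
  ... | M     , inj₂ refl =
    ⊥-elim (¬d≡1-mod-4 M sum≡k (trans (trans (+-comm 1 d) (sym 2k≡1+d)) (double-odd M)))

module Layers {n} (G : Graph n) (d : ℕ) (bounded : ∀ a b → ∃[ m ] m ≤ d × Dist G a b m)
              (u v : Fin n) (u-v : Dist G u v d) where

  open WalkProperties G

  ℓ : Fin n → ℕ
  ℓ y = proj₁ (bounded y u)

  ℓ≤d : ∀ y → ℓ y ≤ d
  ℓ≤d y = proj₁ (proj₂ (bounded y u))

  ℓ-dist : ∀ y → Dist G y u (ℓ y)
  ℓ-dist y = proj₂ (proj₂ (bounded y u))

  ℓ-edge : ∀ {y z} → Edge G y z → ℓ z ≤ suc (ℓ y)
  ℓ-edge e = dist≤length (ℓ-dist _) (edge-sym e ∷ proj₁ (ℓ-dist _))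

  ℓ-adjacent : ∀ {y z} → Edge G y z → ℓ z ≡ suc (ℓ y) ⊎ ℓ z ≡ ℓ y ⊎ ℓ y ≡ suc (ℓ z)
  ℓ-adjacent {y} {z} e with <-cmp (ℓ z) (ℓ y)
  ... | tri< z<y _ _ = inj₂ (inj₂ (≤-antisym (ℓ-edge (edge-sym e)) z<y))
  ... | tri≈ _ z≡y _ = inj₂ (inj₁ z≡y)
  ... | tri> _ _ y<z = inj₁ (≤-antisym (ℓ-edge e) y<z)

  step-down : ∀ {y m} → ℓ y ≡ suc m → ∃[ w ] Edge G y w × ℓ w ≡ m
  step-down {y} ℓy≡1+m with subst (Walk G y u) ℓy≡1+m (proj₁ (ℓ-dist y))
  ... | e ∷ p = _ , e , ≤-antisym (dist≤length (ℓ-dist _) p)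
                                  (≤-pred (subst (_≤ suc (ℓ _)) ℓy≡1+m (ℓ-edge (edge-sym e))))

  ℓ≡0⇒≡u : ∀ {y} → ℓ y ≡ 0 → y ≡ u
  ℓ≡0⇒≡u {y} ℓy≡0 = walk₀⇒≡ (subst (Walk G y u) ℓy≡0 (proj₁ (ℓ-dist y)))

  ℓv≡d : ℓ v ≡ d
  ℓv≡d = ≤-antisym (ℓ≤d v) (dist≤length u-v (reverse (proj₁ (ℓ-dist v))))

  layer-inhabited : ∀ i → i ≤ d → ∃[ w ] ℓ w ≡ i
  layer-inhabited i i≤d = descend (d ∸ i) v (trans ℓv≡d (sym (m+[n∸m]≡n i≤d)))
    where
    descend : ∀ r y → ℓ y ≡ i + r → ∃[ w ] ℓ w ≡ i
    descend zero    y ℓy≡i+0 = y , trans ℓy≡i+0 (+-identityʳ i)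
    descend (suc r) y ℓy≡i+r = let w , _ , ℓw≡ = step-down (trans ℓy≡i+r (+-suc i r)) in descend r w ℓw≡

  module Census (S : Subset n) (td : IsTotalDominating G S) where

    in-layer : ℕ → Fin n → Bool
    in-layer i w = lookup S w ∧ ⌊ ℓ w ≟ i ⌋

    σ : ℕ → ℕ
    σ i = count (in-layer i)

    private
      counted : ∀ {s i} → s ∈ₛ S → ℓ s ≡ i → in-layer i s ≡ true
      counted {s} {i} s∈S ℓs≡i rewrite Vec.[]=⇒lookup s∈S with ℓ s ≟ i
      ... | yes _   = refl
      ... | no ℓs≢i = ⊥-elim (ℓs≢i ℓs≡i)

    σ-≥1 : ∀ {s} → s ∈ₛ S → 1 ≤ σ (ℓ s)
    σ-≥1 {s} s∈S = count-≥1 (in-layer (ℓ s)) (counted s∈S refl)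

    σ-≥2 : ∀ {s s′} → s ∈ₛ S → s′ ∈ₛ S → ℓ s ≡ ℓ s′ → s ≢ s′ → 2 ≤ σ (ℓ s)
    σ-≥2 {s} s∈S s′∈S ℓs≡ℓs′ =
      count-≥2 (in-layer (ℓ s)) (counted s∈S refl) (counted s′∈S (sym ℓs≡ℓs′))

    σ-witness : ∀ {i} → 1 ≤ σ i → ∃[ s ] s ∈ₛ S × ℓ s ≡ i
    σ-witness {i} σi≥1 with count-witness (in-layer i) σi≥1
    ... | s , counted-s with lookup S s in s∈S | ℓ s ≟ i
    ... | true  | yes ℓs≡i = s , Vec.lookup⇒[]= s S s∈S , ℓs≡i
    ... | true  | no _     = case counted-s of λ ()
    ... | false | _        = case counted-s of λ ()

    σ-beyond : ∀ i → d < i → σ i ≡ 0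
    σ-beyond i d<i = count-none (in-layer i) uncounted
      where
      uncounted : ∀ w → in-layer i w ≡ false
      uncounted w with ℓ w ≟ i
      ... | yes ℓw≡i = ⊥-elim (<⇒≱ d<i (subst (_≤ d) ℓw≡i (ℓ≤d w)))
      ... | no _     = ∧-zeroʳ (lookup S w)

    prefixSum-σ : prefixSum σ (suc d) ≡ ∣ S ∣
    prefixSum-σ = begin
      prefixSum σ (suc d)
        ≡⟨ prefixSum-sum-comm (λ w i → indicator (in-layer i w)) (suc d) ⟩
      sum (λ w → prefixSum (λ i → indicator (in-layer i w)) (suc d)) ≡⟨ sum-cong-≗ once ⟩
      count (lookup S)                                               ≡⟨ ∣S∣≡count S ⟨
      ∣ S ∣                                                          ∎
      where
      open ≡-Reasoning
      once : ∀ w → prefixSum (λ i → indicator (in-layer i w)) (suc d) ≡ indicator (lookup S w)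
      once w with lookup S w
      ... | true  = prefixSum-indicator (ℓ w) (suc d) (s≤s (ℓ≤d w))
      ... | false = prefixSum-zero (suc d)

    covered : ∀ i → i ≤ d → 1 ≤ around σ i
    covered i i≤d with layer-inhabited i i≤d
    ... | w , refl = let s , s∈S , e = td w in ≤-trans (σ-≥1 s∈S) (around-one σ (ℓ w) (ℓ s) (ℓ-adjacent e))

    paired : ∀ i → i ≤ d → 1 ≤ σ i → 2 ≤ around σ i
    paired i _ σi≥1 with σ-witness σi≥1
    ... | s , s∈S , refl with td s
    ... | p , p∈S , e with ℓ-adjacent e
    ... | inj₂ (inj₁ ℓp≡ℓs) =
      ≤-trans (σ-≥2 s∈S p∈S (sym ℓp≡ℓs) (edge⇒≢ e)) (around-one σ (ℓ s) (ℓ s) (inj₂ (inj₁ refl)))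
    ... | inj₁ ℓp≡1+ℓs =
      ≤-trans (+-mono-≤ (σ-≥1 s∈S) (σ-≥1 p∈S)) (around-two σ (ℓ s) (ℓ p) (inj₁ ℓp≡1+ℓs))
    ... | inj₂ (inj₂ ℓs≡1+ℓp) =
      ≤-trans (+-mono-≤ (σ-≥1 s∈S) (σ-≥1 p∈S)) (around-two σ (ℓ s) (ℓ p) (inj₂ ℓs≡1+ℓp))

    module Spine (M : ℕ) (d≡ : d ≡ 3 + M * 4) (blocks : ∀ j → j ≤ M → Block0110 σ j) where

      index≤d : ∀ {j} r → r ≤ 3 → j ≤ M → r + j * 4 ≤ d
      index≤d {j} r r≤3 j≤M =
        subst (r + j * 4 ≤_) (sym d≡) (+-mono-≤ r≤3 (*-monoˡ-≤ 4 j≤M))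

      block-of-index : ∀ {r j} → r + j * 4 ≤ d → j ≤ M
      block-of-index {r} {j} r+4j≤d = ≮⇒≥ λ M<j →
        1+n≰n (≤-trans (*-monoˡ-≤ 4 M<j) (≤-trans (m≤n+m (j * 4) r) (subst (r + j * 4 ≤_) d≡ r+4j≤d)))

      σ-first : ∀ j → σ (j * 4) ≡ 0
      σ-first j with j ≤? M
      ... | yes j≤M = proj₁ (blocks j j≤M)
      ... | no  j≰M = σ-beyond _ (subst (_< j * 4) (sym d≡) (*-monoˡ-≤ 4 (≰⇒> j≰M)))

      σ-last : ∀ j → σ (3 + j * 4) ≡ 0
      σ-last j with j ≤? M
      ... | yes j≤M = proj₂ (proj₂ (proj₂ (blocks j j≤M)))
      ... | no  j≰M = σ-beyond _ (subst (_< 3 + j * 4) (sym d≡)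
                        (≤-trans (*-monoˡ-≤ 4 (≰⇒> j≰M)) (m≤n+m (j * 4) 3)))

      not-in-empty-layer : ∀ {s i} → s ∈ₛ S → ℓ s ≡ i → σ i ≡ 0 → ⊥
      not-in-empty-layer s∈S refl σ≡0 = 1+n≰n (subst (1 ≤_) σ≡0 (σ-≥1 s∈S))

      S-layers : ∀ {s} → s ∈ₛ S → ∃[ j ] j ≤ M × (ℓ s ≡ 1 + j * 4 ⊎ ℓ s ≡ 2 + j * 4)
      S-layers {s} s∈S = classify (ℓ s % 4) (ℓ s / 4) (m%n<n (ℓ s) 4) (m≡m%n+[m/n]*n (ℓ s) 4)
        where
        classify : ∀ r j → r < 4 → ℓ s ≡ r + j * 4 →
                   ∃[ j ] j ≤ M × (ℓ s ≡ 1 + j * 4 ⊎ ℓ s ≡ 2 + j * 4)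
        classify 0 j _ ℓs≡ = ⊥-elim (not-in-empty-layer s∈S ℓs≡ (σ-first j))
        classify 1 j _ ℓs≡ = j , block-of-index (subst (_≤ d) ℓs≡ (ℓ≤d s)) , inj₁ ℓs≡
        classify 2 j _ ℓs≡ = j , block-of-index (subst (_≤ d) ℓs≡ (ℓ≤d s)) , inj₂ ℓs≡
        classify 3 j _ ℓs≡ = ⊥-elim (not-in-empty-layer s∈S ℓs≡ (σ-last j))
        classify (suc (suc (suc (suc _)))) _ (s≤s (s≤s (s≤s (s≤s ())))) _

      S-unique-in-layer : ∀ {s s′} → s ∈ₛ S → s′ ∈ₛ S → ℓ s ≡ ℓ s′ → s ≡ s′
      S-unique-in-layer {s} {s′} s∈S s′∈S ℓs≡ℓs′ with s Fin.≟ s′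
      ... | yes s≡s′ = s≡s′
      ... | no  s≢s′ =
        ⊥-elim (1+n≰n (≤-trans (σ-≥2 s∈S s′∈S ℓs≡ℓs′ s≢s′) (≤-reflexive σ≡1)))
        where
        σ≡1 : σ (ℓ s) ≡ 1
        σ≡1 with S-layers s∈S
        ... | j , j≤M , inj₁ ℓs≡ = trans (cong σ ℓs≡) (proj₁ (proj₂ (blocks j j≤M)))
        ... | j , j≤M , inj₂ ℓs≡ = trans (cong σ ℓs≡) (proj₁ (proj₂ (proj₂ (blocks j j≤M))))

      S-below? : ∀ y → Dec (∃[ s ] s ∈ₛ S × ℓ s ≡ ℓ y ∸ 1 × Edge G y s)
      S-below? y = Fin.any? (λ s → (s ∈? S) ×-dec ((ℓ s ≟ ℓ y ∸ 1) ×-dec edge? y s))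

      below? : ∀ y → Dec (∃[ w ] ℓ w ≡ ℓ y ∸ 1 × Edge G y w)
      below? y = Fin.any? (λ w → (ℓ w ≟ ℓ y ∸ 1) ×-dec edge? y w)

      -- Stepping into S whenever possible is what puts every vertex of S on the spine.
      down : Fin n → Fin n
      down y with S-below? y | below? y
      ... | yes (s , _) | _           = s
      ... | no _        | yes (w , _) = w
      ... | no _        | no _        = y

      down-step : ∀ {y m} → ℓ y ≡ suc m → Edge G y (down y) × ℓ (down y) ≡ m
      down-step {y} ℓy≡1+m with S-below? y | below? y
      ... | yes (_ , _ , ℓs≡ , e) | _               = e , trans ℓs≡ (cong (_∸ 1) ℓy≡1+m)
      ... | no _                  | yes (_ , ℓw≡ , e) = e , trans ℓw≡ (cong (_∸ 1) ℓy≡1+m)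
      ... | no _                  | no ∄w           =
        let w , e , ℓw≡m = step-down ℓy≡1+m
        in ⊥-elim (∄w (w , trans ℓw≡m (sym (cong (_∸ 1) ℓy≡1+m)) , e))

      down-in-S : ∀ {y s m} → ℓ y ≡ suc m → s ∈ₛ S → ℓ s ≡ m → Edge G y s → down y ∈ₛ S
      down-in-S {y} {s} ℓy≡1+m s∈S ℓs≡m e with S-below? y | below? y
      ... | yes (_ , s′∈S , _) | _ = s′∈S
      ... | no ∄s              | _ = ⊥-elim (∄s (s , s∈S , trans ℓs≡m (sym (cong (_∸ 1) ℓy≡1+m)) , e))

      from-top : ℕ → Fin n
      from-top zero    = v
      from-top (suc r) = down (from-top r)

      spine : ℕ → Fin n
      spine i = from-top (d ∸ i)

      ℓ-from-top : ∀ r → r ≤ d → ℓ (from-top r) ≡ d ∸ r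
      ℓ-from-top zero    _   = ℓv≡d
      ℓ-from-top (suc r) r<d = proj₂ (down-step (trans (ℓ-from-top r (<⇒≤ r<d)) (+-∸-assoc 1 r<d)))

      ℓ-spine : ∀ {i} → i ≤ d → ℓ (spine i) ≡ i
      ℓ-spine {i} i≤d = trans (ℓ-from-top (d ∸ i) (m∸n≤m d i)) (m∸[m∸n]≡n i≤d)

      spine-down : ∀ {i} → i < d → spine i ≡ down (spine (suc i))
      spine-down i<d = cong from-top (+-∸-assoc 1 i<d)

      spine-edge : ∀ {i} → i < d → Edge G (spine (suc i)) (spine i)
      spine-edge i<d = subst (Edge G _) (sym (spine-down i<d)) (proj₁ (down-step (ℓ-spine i<d)))

      spine-0 : spine 0 ≡ u
      spine-0 = ℓ≡0⇒≡u (ℓ-spine z≤n)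

      spine-S-below : ∀ {i s} → i < d → s ∈ₛ S → Edge G (spine (suc i)) s →
                      ℓ (spine (suc i)) ≡ suc (ℓ s) → spine i ∈ₛ S
      spine-S-below i<d s∈S e ℓ≡1+ℓs =
        subst (_∈ₛ S) (sym (spine-down i<d))
              (down-in-S (ℓ-spine i<d) s∈S (suc-injective (trans (sym ℓ≡1+ℓs) (ℓ-spine i<d))) e)

      spine-second-in-S : ∀ j → j ≤ M → spine (2 + j * 4) ∈ₛ S
      spine-second-in-S j j≤M = from-dominator (td (spine (3 + j * 4)))
        where
        3+4j≤d = index≤d 3 ≤-refl j≤M
        from-dominator : ∃[ s ] s ∈ₛ S × Edge G (spine (3 + j * 4)) s → spine (2 + j * 4) ∈ₛ S
        from-dominator (s , s∈S , e) with ℓ-adjacent e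
        ... | inj₁ ℓs≡ =
          ⊥-elim (not-in-empty-layer s∈S (trans ℓs≡ (cong suc (ℓ-spine 3+4j≤d))) (σ-first (suc j)))
        ... | inj₂ (inj₁ ℓs≡) = ⊥-elim (not-in-empty-layer s∈S (trans ℓs≡ (ℓ-spine 3+4j≤d)) (σ-last j))
        ... | inj₂ (inj₂ ℓy≡) = spine-S-below 3+4j≤d s∈S e ℓy≡

      spine-first-in-S : ∀ j → j ≤ M → spine (1 + j * 4) ∈ₛ S
      spine-first-in-S j j≤M = from-dominator (td (spine (2 + j * 4)))
        where
        2+4j≤d = index≤d 2 (m≤n+m 2 1) j≤M
        from-dominator : ∃[ s ] s ∈ₛ S × Edge G (spine (2 + j * 4)) s → spine (1 + j * 4) ∈ₛ S
        from-dominator (s , s∈S , e) with ℓ-adjacent e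
        ... | inj₁ ℓs≡ = ⊥-elim (not-in-empty-layer s∈S (trans ℓs≡ (cong suc (ℓ-spine 2+4j≤d))) (σ-last j))
        ... | inj₂ (inj₁ ℓs≡) =
          ⊥-elim (edge⇒≢ e (sym (S-unique-in-layer s∈S (spine-second-in-S j j≤M) ℓs≡)))
        ... | inj₂ (inj₂ ℓy≡) = spine-S-below 2+4j≤d s∈S e ℓy≡

      on-spine : ∀ {s i} → s ∈ₛ S → spine i ∈ₛ S → i ≤ d → ℓ s ≡ i → s ≡ spine (ℓ s)
      on-spine s∈S spine∈S i≤d ℓs≡i =
        trans (S-unique-in-layer s∈S spine∈S (trans ℓs≡i (sym (ℓ-spine i≤d)))) (cong spine (sym ℓs≡i))

      S-on-spine : ∀ {s} → s ∈ₛ S → s ≡ spine (ℓ s) × 1 ≤ ℓ s × ℓ s < d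
      S-on-spine {s} s∈S with S-layers s∈S
      ... | j , j≤M , inj₁ ℓs≡ =
        on-spine s∈S (spine-first-in-S j j≤M) (index≤d 1 (s≤s z≤n) j≤M) ℓs≡ ,
        subst (1 ≤_) (sym ℓs≡) (s≤s z≤n) , subst (_< d) (sym ℓs≡) (index≤d 2 (m≤n+m 2 1) j≤M)
      ... | j , j≤M , inj₂ ℓs≡ =
        on-spine s∈S (spine-second-in-S j j≤M) (index≤d 2 (m≤n+m 2 1) j≤M) ℓs≡ ,
        subst (1 ≤_) (sym ℓs≡) (s≤s z≤n) , subst (_< d) (sym ℓs≡) (index≤d 3 ≤-refl j≤M)

module ParentGraph {n} (parent : Fin n → Fin n) (rank : Fin n → ℕ)
                   (rank-parent : ∀ a → parent a ≢ a → rank (parent a) < rank a) where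

  Link : Fin n → Fin n → Set
  Link a b = a ≢ b × (parent a ≡ b ⊎ parent b ≡ a)

  link? : ∀ a b → Dec (Link a b)
  link? a b = ¬? (a Fin.≟ b) ×-dec (parent a Fin.≟ b ⊎-dec parent b Fin.≟ a)

  link-sym : ∀ {a b} → Link a b → Link b a
  link-sym (a≢b , inj₁ e) = a≢b ∘ sym , inj₂ e
  link-sym (a≢b , inj₂ e) = a≢b ∘ sym , inj₁ e

  tree : Graph n
  tree = record { adj = λ a b → ⌊ link? a b ⌋ ; sym = symmetric ; irrefl = irreflexive }
    where
    symmetric : ∀ a b → ⌊ link? a b ⌋ ≡ ⌊ link? b a ⌋
    symmetric a b with link? a b | link? b a
    ... | yes _  | yes _  = refl
    ... | no _   | no _   = refl
    ... | yes ab | no ¬ba = ⊥-elim (¬ba (link-sym ab))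
    ... | no ¬ab | yes ba = ⊥-elim (¬ab (link-sym ba))
    irreflexive : ∀ a → ⌊ link? a a ⌋ ≡ false
    irreflexive a with link? a a
    ... | yes (a≢a , _) = ⊥-elim (a≢a refl)
    ... | no _          = refl

  edge⇒link : ∀ {a b} → Edge tree a b → Link a b
  edge⇒link {a} {b} e with link? a b
  ... | yes ab = ab

  link⇒edge : ∀ {a b} → Link a b → Edge tree a b
  link⇒edge {a} {b} ab with link? a b
  ... | yes _  = refl
  ... | no ¬ab = ⊥-elim (¬ab ab)

  rank-< : ∀ {a b} → parent b ≡ a → a ≢ b → rank a < rank b
  rank-< refl a≢b = rank-parent _ a≢b

  penultimate : Fin n → List (Fin n) → Fin n
  penultimate a []            = a
  penultimate a (w ∷ [])      = a
  penultimate a (w ∷ w′ ∷ ws) = penultimate w (w′ ∷ ws)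

  penultimate-∈ : ∀ a ws → penultimate a ws ∈ a ∷ ws
  penultimate-∈ a []            = here refl
  penultimate-∈ a (w ∷ [])      = here refl
  penultimate-∈ a (w ∷ w′ ∷ ws) = there (penultimate-∈ w (w′ ∷ ws))

  last-∈ : ∀ {a w ws b} → Path tree a (w ∷ ws) b → b ∈ w ∷ ws
  last-∈ (step _ one)        = here refl
  last-∈ (step _ (step e p)) = there (last-∈ (step e p))

  last-link : ∀ {a w ws b} → Path tree a (w ∷ ws) b → Link (penultimate a (w ∷ ws)) b
  last-link (step e one)        = edge⇒link e
  last-link (step _ (step e p)) = last-link (step e p)

  -- On a path without repetitions, a step from a parent down to its child can only be
  -- followed by further such steps, since the child's parent lies behind.
  descending : ∀ {a w ws b} → Path tree a (w ∷ ws) b → Unique (a ∷ w ∷ ws) → parent w ≡ a →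
               rank a < rank b × parent b ≡ penultimate a (w ∷ ws)
  descending (step e one) _ pw≡a = rank-< pw≡a (proj₁ (edge⇒link e)) , pw≡a
  descending (step e (step e′ p)) (a∉ ∷ unique) pw≡a with edge⇒link e′
  ... | _ , inj₁ pw≡w′ = ⊥-elim (All.lookup a∉ (there (here refl)) (trans (sym pw≡a) pw≡w′))
  ... | _ , inj₂ pw′≡w =
    let a<b , pb≡ = descending (step e′ p) unique pw′≡w
    in <-trans (rank-< pw≡a (proj₁ (edge⇒link e))) a<b , pb≡

  ascending : ∀ {a w ws b} → Path tree a (w ∷ ws) b → Unique (a ∷ w ∷ ws) →
              parent (penultimate a (w ∷ ws)) ≡ b → rank b < rank a
  ascending (step e one) _ pa≡b = rank-< pa≡b (proj₁ (edge⇒link e) ∘ sym)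
  ascending (step e (step e′ p)) (a∉ ∷ unique) pp≡b with edge⇒link e
  ... | a≢w , inj₁ pa≡w = <-trans (ascending (step e′ p) unique pp≡b) (rank-< pa≡w (a≢w ∘ sym))
  ... | _   , inj₂ pw≡a =
    let last = last-link (step e (step e′ p))
        _ , pb≡ = descending (step e (step e′ p)) (a∉ ∷ unique) pw≡a
    in ⊥-elim (<-asym (rank-< pb≡ (proj₁ last)) (rank-< pp≡b (proj₁ last ∘ sym)))

  acyclic : Acyclic tree
  acyclic []                   ()
  acyclic (c ∷ [])             (_ , s≤s () , _)
  acyclic (c ∷ w ∷ [])         (_ , s≤s (s≤s ()) , _)
  acyclic (c ∷ w ∷ w′ ∷ ws) (unique@(c∉ ∷ w∉ ∷ _) , _ , y , path@(step e rest) , closing)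
    with edge⇒link e | edge⇒link closing
  ... | _ , inj₂ pw≡c | _ , closing-link =
    let c<y , py≡ = descending path unique pw≡c in
    case closing-link of λ where
      (inj₁ py≡c) → All.lookup c∉ (penultimate-∈ w (w′ ∷ ws)) (trans (sym py≡c) py≡)
      (inj₂ pc≡y) → <-asym c<y (rank-< pc≡y (All.lookup c∉ (last-∈ path) ∘ sym))
  ... | _ , inj₁ pc≡w | _ , inj₂ pc≡y = All.lookup w∉ (last-∈ rest) (trans (sym pc≡w) pc≡y)
  ... | _ , inj₁ pc≡w | _ , inj₁ py≡c with last-link path
  ...   | _ , inj₁ pp≡y = <-asym (ascending path unique pp≡y) (rank-< py≡c (All.lookup c∉ (last-∈ path)))
  ...   | _ , inj₂ py≡p = All.lookup c∉ (penultimate-∈ w (w′ ∷ ws)) (trans (sym py≡c) py≡p)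

  degree-≥2 : ∀ {v w₁ w₂} → Link v w₁ → Link v w₂ → w₁ ≢ w₂ → 2 ≤ degree tree v
  degree-≥2 {v} l₁ l₂ w₁≢w₂ =
    subst (2 ≤_) (sym (∣tabulate∣≡count (adj tree v)))
          (count-≥2 (adj tree v) (link⇒edge l₁) (link⇒edge l₂) w₁≢w₂)

  degree-≡1 : ∀ {v w} → Link v w → (∀ w′ → Link v w′ → w′ ≡ w) → degree tree v ≡ 1
  degree-≡1 {v} l unique =
    trans (∣tabulate∣≡count (adj tree v))
          (count-unique (adj tree v) (link⇒edge l) (λ w′ e → unique w′ (edge⇒link e)))

module SpineCaterpillar {n} (G : Graph n) (d : ℕ) (1≤d : 1 ≤ d)
  (spine : ℕ → Fin n) (position : Fin n → ℕ) (position≤d : ∀ y → position y ≤ d)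
  (position-spine : ∀ {i} → i ≤ d → position (spine i) ≡ i)
  (spine-edge : ∀ {i} → i < d → Edge G (spine (suc i)) (spine i))
  (spine-dist : Dist G (spine d) (spine 0) d)
  (anchor : Fin n → Fin n) (anchor-edge : ∀ y → Edge G y (anchor y))
  (anchor-interior : ∀ y → anchor y ≡ spine (position (anchor y))
                         × 1 ≤ position (anchor y) × position (anchor y) < d) where

  spine-injective : ∀ {i j} → i ≤ d → j ≤ d → spine i ≡ spine j → i ≡ j
  spine-injective i≤d j≤d e = trans (sym (position-spine i≤d)) (trans (cong position e) (position-spine j≤d))

  OnSpine : Fin n → Set
  OnSpine y = y ≡ spine (position y)

  on-spine? : ∀ y → Dec (OnSpine y)
  on-spine? y = y Fin.≟ spine (position y)

  spine-on-spine : ∀ {i} → i ≤ d → OnSpine (spine i)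
  spine-on-spine i≤d = cong spine (sym (position-spine i≤d))

  parent : Fin n → Fin n
  parent y with on-spine? y
  ... | yes _ = spine (position y ∸ 1)
  ... | no _  = anchor y

  rank : Fin n → ℕ
  rank y with on-spine? y
  ... | yes _ = position y
  ... | no _  = suc d

  parent-spine : ∀ {y} → OnSpine y → parent y ≡ spine (position y ∸ 1)
  parent-spine {y} y-on with on-spine? y
  ... | yes _    = refl
  ... | no y-off = ⊥-elim (y-off y-on)

  parent-off-spine : ∀ {y} → ¬ OnSpine y → parent y ≡ anchor y
  parent-off-spine {y} y-off with on-spine? y
  ... | yes y-on = ⊥-elim (y-off y-on)
  ... | no _     = refl

  rank-spine : ∀ {y} → OnSpine y → rank y ≡ position y
  rank-spine {y} y-on with on-spine? y
  ... | yes _    = refl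
  ... | no y-off = ⊥-elim (y-off y-on)

  parent-on-spine : ∀ y → OnSpine (parent y)
  parent-on-spine y with on-spine? y
  ... | yes _ = spine-on-spine (≤-trans (m∸n≤m _ 1) (position≤d y))
  ... | no _  = proj₁ (anchor-interior y)

  parent-edge : ∀ y → parent y ≢ y → Edge G y (parent y)
  parent-edge y _ with on-spine? y
  parent-edge y _      | no _ = anchor-edge y
  parent-edge y p≢y    | yes y-on with position y in eq
  ... | zero  = ⊥-elim (p≢y (sym y-on))
  ... | suc m = subst (λ z → Edge G z (spine m)) (sym y-on) (spine-edge (subst (_≤ d) eq (position≤d y)))

  rank-parent : ∀ y → parent y ≢ y → rank (parent y) < rank y
  rank-parent y _ with on-spine? y
  rank-parent y _   | no _ =
    subst (_< suc d) (sym (rank-spine (proj₁ (anchor-interior y)))) (m<n⇒m<1+n (proj₂ (proj₂ (anchor-interior y))))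
  rank-parent y p≢y | yes y-on with position y in eq
  ... | zero  = ⊥-elim (p≢y (sym y-on))
  ... | suc m = subst (_< suc m) (sym (trans (rank-spine (spine-on-spine m≤d)) (position-spine m≤d))) ≤-refl
    where m≤d = ≤-trans (n≤1+n m) (subst (_≤ d) eq (position≤d y))

  open ParentGraph parent rank rank-parent public

  spanning : SpanningSubgraph tree G
  spanning a b e with edge⇒link e
  ... | a≢b , inj₁ pa≡b = subst (Edge G a) pa≡b (parent-edge a λ pa≡a → a≢b (trans (sym pa≡a) pa≡b))
  ... | a≢b , inj₂ pb≡a = WalkProperties.edge-sym G
                            (subst (Edge G b) pb≡a (parent-edge b λ pb≡b → a≢b (trans (sym pb≡a) pb≡b)))

  spine-parent : ∀ {i} → i ≤ d → parent (spine i) ≡ spine (i ∸ 1)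
  spine-parent {i} i≤d =
    trans (parent-spine (spine-on-spine i≤d)) (cong (λ j → spine (j ∸ 1)) (position-spine i≤d))

  spine-link : ∀ {i} → i < d → Link (spine (suc i)) (spine i)
  spine-link {i} i<d = (1+n≢n ∘ spine-injective i<d (<⇒≤ i<d)) , inj₁ (spine-parent i<d)

  spine-walk : ∀ r i → i + r ≤ d → Walk tree (spine (i + r)) (spine i) r
  spine-walk zero    i _      = subst (λ j → Walk tree (spine j) (spine i) 0) (sym (+-identityʳ i)) []
  spine-walk (suc r) i i+r≤d = subst (λ j → Walk tree (spine j) (spine i) (suc r)) (sym (+-suc i r))
    (link⇒edge (spine-link i+r<d) ∷ spine-walk r i (<⇒≤ i+r<d))
    where i+r<d = subst (_≤ d) (+-suc i r) i+r≤d

  spine-descent : ∀ {a b} → b ≤ a → a ≤ d → Walk tree (spine a) (spine b) (a ∸ b)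
  spine-descent {a} {b} b≤a a≤d =
    subst (λ j → Walk tree (spine j) (spine b) (a ∸ b)) (m+[n∸m]≡n b≤a)
          (spine-walk (a ∸ b) b (subst (_≤ d) (sym (m+[n∸m]≡n b≤a)) a≤d))

  -- Both bounds hold because anchors are interior; together they keep tree distances within d.
  record SpineAccess (y : Fin n) : Set where
    field
      foot offset     : ℕ
      walk            : Walk tree y (spine foot) offset
      offset≤foot     : offset ≤ foot
      offset+foot≤d   : offset + foot ≤ d

  spine-access : ∀ y → SpineAccess y
  spine-access y with on-spine? y
  ... | yes y-on = record
    { foot = position y ; offset = 0 ; walk = subst (λ z → Walk tree y z 0) y-on []
    ; offset≤foot = z≤n ; offset+foot≤d = position≤d y }
  ... | no y-off = record
    { foot = position (anchor y) ; offset = 1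
    ; walk = subst (λ z → Walk tree y z 1) (proj₁ (anchor-interior y)) (link⇒edge y-anchor ∷ [])
    ; offset≤foot = proj₁ (proj₂ (anchor-interior y)) ; offset+foot≤d = proj₂ (proj₂ (anchor-interior y)) }
    where
    y-anchor : Link y (anchor y)
    y-anchor = (λ y≡a → y-off (subst OnSpine (sym y≡a) (proj₁ (anchor-interior y))))
             , inj₁ (parent-off-spine y-off)

  private
    detour-bound : ∀ a b δ₁ δ₂ → b ≤ a → δ₁ + a ≤ d → δ₂ ≤ b → δ₁ + ((a ∸ b) + δ₂) ≤ d
    detour-bound a b δ₁ δ₂ b≤a δ₁+a≤d δ₂≤b =
      ≤-trans (+-monoʳ-≤ δ₁ (≤-trans (+-monoʳ-≤ (a ∸ b) δ₂≤b) (≤-reflexive (m∸n+n≡m b≤a)))) δ₁+a≤d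

    walk-via-spine : ∀ {y z} (p : SpineAccess y) (q : SpineAccess z) →
                     SpineAccess.foot q ≤ SpineAccess.foot p → ∃[ L ] L ≤ d × Walk tree y z L
    walk-via-spine p q q≤p =
      _ , detour-bound P.foot Q.foot P.offset Q.offset q≤p P.offset+foot≤d Q.offset≤foot ,
      (P.walk ++ (spine-descent q≤p (≤-trans (m≤n+m _ _) P.offset+foot≤d) ++ reverse Q.walk))
      where
      module P = SpineAccess p
      module Q = SpineAccess q
      open WalkProperties tree

  tree-walk : ∀ y z → ∃[ L ] L ≤ d × Walk tree y z L
  tree-walk y z with ≤-total (SpineAccess.foot (spine-access z)) (SpineAccess.foot (spine-access y))
  ... | inj₁ z≤y = walk-via-spine (spine-access y) (spine-access z) z≤y
  ... | inj₂ y≤z = let L , L≤d , w = walk-via-spine (spine-access z) (spine-access y) y≤z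
                   in L , L≤d , WalkProperties.reverse tree w

  connected : Connected tree
  connected y z = let L , _ , w = tree-walk y z in L , w

  diameter : Diam tree d
  diameter = (λ y z → let L , L≤d , w = tree-walk y z
                          k , k≤L , dist = WalkProperties.shortest tree w
                      in k , ≤-trans k≤L L≤d , dist)
           , spine d , spine 0 , spine-walk d 0 ≤-refl
           , λ k k<d w → proj₂ spine-dist k k<d (walk-mono spanning w)

  spine-child : ∀ {w i} → OnSpine w → i ≤ d → parent w ≡ spine i → w ≢ spine i → position w ≡ suc i
  spine-child {w} {i} w-on i≤d pw≡ w≢ =
    trans (sym (m∸n+n≡m 1≤p)) (trans (cong (_+ 1) p∸1≡i) (+-comm i 1))
    where
    p∸1≡i : position w ∸ 1 ≡ i
    p∸1≡i = spine-injective (≤-trans (m∸n≤m _ 1) (position≤d w)) i≤d (trans (sym (parent-spine w-on)) pw≡)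
    1≤p : 1 ≤ position w
    1≤p = n≢0⇒n>0 λ p≡0 →
      w≢ (trans w-on (cong spine (trans p≡0 (trans (sym (cong (_∸ 1) p≡0)) p∸1≡i))))

  anchored-child : ∀ {w i} → ¬ OnSpine w → i ≤ d → parent w ≡ spine i → 1 ≤ i × i < d
  anchored-child {w} w-off i≤d pw≡ =
    subst (λ j → 1 ≤ j × j < d)
          (spine-injective (position≤d _) i≤d (trans (sym (proj₁ (anchor-interior w))) anchor≡))
          (proj₂ (anchor-interior w))
    where anchor≡ = trans (sym (parent-off-spine w-off)) pw≡

  off-spine-leaf : ∀ {v} → ¬ OnSpine v → degree tree v ≡ 1
  off-spine-leaf {v} v-off = degree-≡1 (v≢pv , inj₁ refl) only-parent
    where
    v≢pv : v ≢ parent v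
    v≢pv v≡pv = v-off (subst OnSpine (sym v≡pv) (parent-on-spine v))
    only-parent : ∀ w → Link v w → w ≡ parent v
    only-parent w (_ , inj₁ pv≡w) = sym pv≡w
    only-parent w (_ , inj₂ pw≡v) = ⊥-elim (v-off (subst OnSpine pw≡v (parent-on-spine w)))

  first-leaf : degree tree (spine 0) ≡ 1
  first-leaf = degree-≡1 (link-sym (spine-link 1≤d)) only-next
    where
    only-next : ∀ w → Link (spine 0) w → w ≡ spine 1
    only-next w (≢w , inj₁ p0≡w) = ⊥-elim (≢w (trans (sym (spine-parent z≤n)) p0≡w))
    only-next w (≢w , inj₂ pw≡0) = case on-spine? w of λ where
      (yes w-on) → trans w-on (cong spine (spine-child w-on z≤n pw≡0 (≢w ∘ sym)))
      (no w-off) → ⊥-elim (1+n≰n (proj₁ (anchored-child w-off z≤n pw≡0)))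

  last-leaf : degree tree (spine d) ≡ 1
  last-leaf = degree-≡1 (subst (λ j → Link (spine j) (spine (d ∸ 1))) 1+[d∸1]≡d (spine-link d∸1<d)) only-previous
    where
    1+[d∸1]≡d : suc (d ∸ 1) ≡ d
    1+[d∸1]≡d = trans (+-comm 1 (d ∸ 1)) (m∸n+n≡m 1≤d)
    d∸1<d : d ∸ 1 < d
    d∸1<d = ≤-reflexive 1+[d∸1]≡d
    only-previous : ∀ w → Link (spine d) w → w ≡ spine (d ∸ 1)
    only-previous w (_ , inj₁ pd≡w) = trans (sym pd≡w) (spine-parent ≤-refl)
    only-previous w (≢w , inj₂ pw≡d) = ⊥-elim (case on-spine? w of λ where
      (yes w-on) → 1+n≰n (subst (_≤ d) (spine-child w-on ≤-refl pw≡d (≢w ∘ sym)) (position≤d w))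
      (no w-off) → <-irrefl refl (proj₂ (anchored-child w-off ≤-refl pw≡d)))

  interior : List (Fin n)
  interior = List.applyUpTo (spine ∘ suc) (d ∸ 1)

  private
    <∸1 : ∀ {i} m → i < m ∸ 1 → suc i < m
    <∸1 (suc m) i<m = s≤s i<m

  interior-unique : Unique interior
  interior-unique = applyUpTo⁺₁ (spine ∘ suc) (d ∸ 1) λ i<j j<d∸1 e →
    <⇒≢ i<j (suc-injective (spine-injective (<⇒≤ (<∸1 d (<-trans i<j j<d∸1))) (<⇒≤ (<∸1 d j<d∸1)) e))

  interior-not-leaf : ∀ {v} → v ∈ interior → 2 ≤ degree tree v
  interior-not-leaf v∈ with ∈-applyUpTo⁻ (spine ∘ suc) v∈
  ... | i , i<d∸1 , refl =
    degree-≥2 (spine-link (<⇒≤ 1+i<d)) (link-sym (spine-link 1+i<d))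
              (<⇒≢ (m<n+m i (s≤s z≤n)) ∘ spine-injective (≤-trans (n≤1+n i) (<⇒≤ 1+i<d)) 1+i<d)
    where 1+i<d = <∸1 d i<d∸1

  exterior-leaf : ∀ {v} → ¬ v ∈ interior → degree tree v ≡ 1
  exterior-leaf {v} v∉ = by-kind (on-spine? v)
    where
    by-kind : Dec (OnSpine v) → degree tree v ≡ 1
    by-kind (no v-off) = off-spine-leaf v-off
    by-kind (yes v-on) with position v ≟ 0 | position v ≟ d
    ... | yes p≡0 | _       = subst (λ y → degree tree y ≡ 1) (sym (trans v-on (cong spine p≡0))) first-leaf
    ... | no _    | yes p≡d = subst (λ y → degree tree y ≡ 1) (sym (trans v-on (cong spine p≡d))) last-leaf
    ... | no p≢0  | no p≢d  =
      ⊥-elim (v∉ (subst (_∈ interior) spine≡v (∈-applyUpTo⁺ (spine ∘ suc) p∸1<d∸1)))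
      where
      p∸1<d∸1 : position v ∸ 1 < d ∸ 1
      p∸1<d∸1 = ∸-monoˡ-< (≤∧≢⇒< (position≤d v) p≢d) (n≢0⇒n>0 p≢0)
      spine≡v : spine (suc (position v ∸ 1)) ≡ v
      spine≡v = trans (cong spine (trans (+-comm 1 _) (m∸n+n≡m (n≢0⇒n>0 p≢0)))) (sym v-on)

  interior-iff-not-leaf : ∀ v → (v ∈ interior) ⇔ (¬ IsLeaf tree v)
  interior-iff-not-leaf v = mk⇔
    (λ v∈ leaf → 1+n≰n (subst (2 ≤_) leaf (interior-not-leaf v∈)))
    (λ ¬leaf → decidable-stable (any? (v Fin.≟_) interior) (¬leaf ∘ exterior-leaf))

  spine-link-iff : ∀ {i j} → suc i ≤ d → suc j ≤ d →
                   Link (spine (suc i)) (spine (suc j)) ⇔ (i ≡ suc j ⊎ j ≡ suc i)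
  spine-link-iff {i} {j} 1+i≤d 1+j≤d = mk⇔ to from
    where
    i≡j : spine (suc i) ≡ spine (suc j) → i ≡ j
    i≡j = suc-injective ∘ spine-injective 1+i≤d 1+j≤d
    to : Link (spine (suc i)) (spine (suc j)) → i ≡ suc j ⊎ j ≡ suc i
    to (_ , inj₁ p≡) = inj₁ (spine-injective (<⇒≤ 1+i≤d) 1+j≤d (trans (sym (spine-parent 1+i≤d)) p≡))
    to (_ , inj₂ p≡) = inj₂ (spine-injective (<⇒≤ 1+j≤d) 1+i≤d (trans (sym (spine-parent 1+j≤d)) p≡))
    from : i ≡ suc j ⊎ j ≡ suc i → Link (spine (suc i)) (spine (suc j))
    from (inj₁ i≡1+j) = (λ e → 1+n≢n (trans (sym i≡1+j) (i≡j e))) ,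
                        inj₁ (trans (spine-parent 1+i≤d) (cong spine i≡1+j))
    from (inj₂ j≡1+i) = (λ e → 1+n≢n (trans (sym j≡1+i) (sym (i≡j e)))) ,
                        inj₂ (trans (spine-parent 1+j≤d) (cong spine j≡1+i))

  interior-adjacency : ∀ (i j : Fin (length interior)) →
    Edge tree (List.lookup interior i) (List.lookup interior j) ⇔ (toℕ i ≡ suc (toℕ j) ⊎ toℕ j ≡ suc (toℕ i))
  interior-adjacency i j = mk⇔
    (Equivalence.to iff ∘ edge⇒link ∘ subst₂ (Edge tree) (lookup-interior i) (lookup-interior j))
    (subst₂ (Edge tree) (sym (lookup-interior i)) (sym (lookup-interior j)) ∘ link⇒edge ∘ Equivalence.from iff)
    where
    lookup-interior : ∀ k → List.lookup interior k ≡ spine (suc (toℕ k))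
    lookup-interior = List.lookup-applyUpTo (spine ∘ suc) (d ∸ 1)
    bound : ∀ k → suc (toℕ k) ≤ d
    bound k = <⇒≤ (<∸1 d (subst (toℕ k <_) (List.length-applyUpTo (spine ∘ suc) (d ∸ 1)) (Fin.toℕ<n k)))
    iff = spine-link-iff (bound i) (bound j)

  caterpillar : IsCaterpillar tree
  caterpillar = (connected , acyclic) , interior , interior-unique , interior-iff-not-leaf , interior-adjacency

theorem3p4 : ∀ (n : ℕ) (G : Graph n) → 2 ≤ n → Connected G →
    ∀ (γ d : ℕ) → TotalDominationNumber G γ → Diam G d →
    2 * γ ≡ d + 1 →
    Σ (Graph n) λ T → SpanningSubgraph T G × IsCaterpillar T × Diam T d
theorem3p4 n G _ _ γ d ((S , td , ∣S∣≡γ) , _) (bounded , u , v , u-v) 2γ≡d+1 =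
  tree , spanning , caterpillar , diameter
  where
  open Layers G d bounded u v u-v
  open Census S td
  open BlockPattern σ d (σ-beyond (suc d) ≤-refl) covered paired
  pattern-of-σ = block-pattern γ (trans prefixSum-σ ∣S∣≡γ) 2γ≡d+1
  M = proj₁ pattern-of-σ
  d≡3+4M = proj₁ (proj₂ pattern-of-σ)
  open Spine M d≡3+4M (proj₂ (proj₂ pattern-of-σ))
  open SpineCaterpillar G d (subst (1 ≤_) (sym d≡3+4M) (s≤s z≤n)) spine ℓ ℓ≤d ℓ-spine spine-edge
         (subst₂ (Dist G (spine d)) (sym spine-0) (ℓ-spine ≤-refl) (ℓ-dist (spine d)))
         (proj₁ ∘ td) (proj₂ ∘ proj₂ ∘ td) (S-on-spine ∘ proj₁ ∘ proj₂ ∘ td)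
    using (tree; spanning; caterpillar; diameter)
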